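{- Let $M=(N,\mathcal{I})$ be a laminar matroid given by a laminar family $\mathcal{L}$ with bounds $b_L\ge1$ and $N\in\mathcal{L}$, with $N=\{f_1,\dots,f_n\}$ numbered so that each $L\in\mathcal{L}$ consists of consecutively numbered elements. Let $I\in\mathcal{I}$ and let $J\subseteq N$ satisfy $|J\cap\widetilde{P}|\le1$ for all $\widetilde{P}\in\widetilde{\mathcal{P}}(I)$. Then $J\in\mathcal{I}$.
   Context: Laminar matroid: $\mathcal{L}\subseteq2^N$ laminar (members pairwise disjoint or nested), $\mathcal{I}=\{J\subseteq N\mid |J\cap L|\le b_L\ \forall L\in\mathcal{L}\}$. Partition $\widetilde{\mathcal{P}}(I)$: if $I=\emptyset$, $\widetilde{\mathcal{P}}(I)=\{N\}$. Otherwise, for each element $f_i\in N$, let $L\in\mathcal{L}$ be the smallest set of $\mathcal{L}$ containing $f_i$ with $L\cap I\neq\emptyset$; if $L\cap I$ contains some $f_j$ with $j\le i$ let $j$ be the largest such index, otherwise let $j$ be the smallest index $j>i$ with $f_j\in L\cap I$; assign $f_i$ to $N_{f_j}$. Then $\widetilde{\mathcal{P}}(I)=\{N_f\mid f\in I\}$. -}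

module Defs where

open import Data.Nat using (ℕ; _≤_; _<_)
open import Data.Fin using (Fin; toℕ)
open import Data.Fin.Subset using (Subset; _∈_; _⊆_; _∩_; ∣_∣; ⊤; Nonempty; Empty)
open import Data.Product using (Σ; _×_; ∃)
open import Data.Sum using (_⊎_)
open import Relation.Binary.PropositionalEquality using (_≡_)
open import Relation.Nullary using (¬_)
open import Function.Definitions using (Injective)
open import Data.Empty renaming (⊥ to ⊥')

-- Ground set N = {f_1,…,f_n} is represented by Fin n (f_{i+1} ↦ i), so the
-- numbering of N is the natural order on Fin n.
-- A laminar family with bounds is given by an injective indexing
-- L : Fin m → Subset n (the members of 𝓛) and bounds b : Fin m → ℕ.

Laminar : ∀ {n m} → (Fin m → Subset n) → Set
Laminar {n} L = ∀ k k' →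
  (∀ (x : Fin n) → x ∈ L k → x ∈ L k' → ⊥') ⊎ (L k ⊆ L k' ⊎ L k' ⊆ L k)

Consecutive : ∀ {n} → Subset n → Set
Consecutive {n} S = ∀ (x y z : Fin n) → x ∈ S → z ∈ S →
  toℕ x ≤ toℕ y → toℕ y ≤ toℕ z → y ∈ S

Independent : ∀ {n m} → (Fin m → Subset n) → (Fin m → ℕ) → Subset n → Set
Independent L b J = ∀ k → ∣ J ∩ L k ∣ ≤ b k

SmallestMeeting : ∀ {n m} → (Fin m → Subset n) → Subset n → Fin n → Fin m → Set
SmallestMeeting L I x k =
  x ∈ L k × Nonempty (L k ∩ I) ×
  (∀ k' → x ∈ L k' → Nonempty (L k' ∩ I) → L k ⊆ L k')

-- Given the set S = L ∩ I, element f_x is assigned to N_{f_j}: j is the largest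
-- index ≤ x in S if there is one, otherwise the smallest index > x in S.
ChosenIn : ∀ {n} → Subset n → Fin n → Fin n → Set
ChosenIn {n} S x j =
  (j ∈ S × toℕ j ≤ toℕ x × (∀ j' → j' ∈ S → toℕ j' ≤ toℕ x → toℕ j' ≤ toℕ j))
  ⊎
  ((¬ Σ (Fin n) λ j' → j' ∈ S × toℕ j' ≤ toℕ x) ×
   j ∈ S × toℕ x < toℕ j × (∀ j' → j' ∈ S → toℕ x < toℕ j' → toℕ j ≤ toℕ j'))

-- Assigned L I f x : (for I ≠ ∅) element x belongs to the part N_f of P̃(I)
Assigned : ∀ {n m} → (Fin m → Subset n) → Subset n → Fin n → Fin n → Set
Assigned L I f x = ∃ λ k → SmallestMeeting L I x k × ChosenIn (L k ∩ I) x f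

AtMostOneIn : ∀ {n} → Subset n → (Fin n → Set) → Set
AtMostOneIn J P = ∀ x y → x ∈ J → y ∈ J → P x → P y → x ≡ y

MeetsPartsAtMostOnce : ∀ {n m} → (Fin m → Subset n) → Subset n → Subset n → Set
MeetsPartsAtMostOnce L I J =
  (Empty I → AtMostOneIn J (λ x → x ∈ ⊤)) ×
  (∀ f → f ∈ I → AtMostOneIn J (Assigned L I f))

-- Pick in every part of P̃(I) its defining element of I; this is a function
-- x ↦ f(x) on N with f(x) ∈ I.  Fix L ∈ 𝓛.  If L meets I then f maps L into
-- L ∩ I (the smallest member of 𝓛 meeting I around x ∈ L lies inside L), and
-- f is injective on J because J meets every part at most once, so
-- |J ∩ L| ≤ |I ∩ L| ≤ b_L.  If L misses I then every x ∈ L has the same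
-- smallest member around it, and since L is an interval avoiding I, all of
-- L sees the same elements of I on its left and on its right; hence L lies
-- in a single part and |J ∩ L| ≤ 1 ≤ b_L.
module Submission where

open import Defs
open import Data.Empty using (⊥-elim)
open import Data.Fin using (Fin; zero; suc; toℕ)
open import Data.Fin.Induction using (<-wellFounded; >-wellFounded)
open import Data.Fin.Properties using (any?; suc-injective; 0≢1+n)
import Data.Fin.Properties as Fin
open import Data.Fin.Subset
  using (Subset; _∈_; _∉_; _⊆_; _∩_; _-_; ∣_∣; ⊤; Nonempty; Empty; inside; outside)
open import Data.Fin.Subset.Properties
  using ( _∈?_; nonempty?; ∈⊤; x∈p∩q⁺; x∈p∩q⁻; x∈p∧x≢y⇒x∈p-y; x∈p⇒∣p-x∣<∣p∣
        ; p⊂q⇒∣p∣<∣q∣; ∣p∩q∣≤∣p∣ )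
open import Data.Nat using (ℕ; _≤_; _<_; z≤n; s≤s)
import Data.Nat.Induction as ℕ
open import Data.Nat.Properties using (≤-trans; ≮⇒≥; ≰⇒>; <⇒≤; <⇒≱)
import Data.Nat.Properties as ℕ
open import Data.Product using (∃; _×_; _,_; proj₁; proj₂)
open import Data.Sum using (_⊎_; inj₁; inj₂)
open import Data.Vec using (_∷_; []; here; there)
open import Function using (_∘_)
open import Function.Definitions using (Injective)
open import Induction.WellFounded using (WellFounded; Acc; acc)
open import Relation.Binary using (Rel)
import Relation.Binary as B
import Relation.Binary.Construct.On as On
open import Relation.Binary.PropositionalEquality using (_≡_; sym; subst)
open import Relation.Nullary using (¬_; yes; no; Dec)
open import Relation.Nullary.Decidable using (_×-dec_)
open import Relation.Unary using (Pred; Decidable)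

module _ {m p r} {P : Pred (Fin m) p} {_≺_ : Rel (Fin m) r}
         (P? : Decidable P) (_≺?_ : B.Decidable _≺_) where

  minimal-from : ∀ {k} → Acc _≺_ k → P k → ∃ λ k → P k × ∀ k' → P k' → ¬ k' ≺ k
  minimal-from {k} (acc rs) pk with any? (λ k' → P? k' ×-dec (k' ≺? k))
  ... | yes (k' , pk' , k'≺k) = minimal-from (rs k'≺k) pk'
  ... | no ∄smaller = k , pk , λ k' pk' k'≺k → ∄smaller (k' , pk' , k'≺k)

  minimal : WellFounded _≺_ → ∃ P → ∃ λ k → P k × ∀ k' → P k' → ¬ k' ≺ k
  minimal wf (k , pk) = minimal-from (wf k) pk

∣p∣≤∣q∣-injection : ∀ {n n'} (p : Subset n) {q : Subset n'} (g : Fin n → Fin n') →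
  (∀ {x} → x ∈ p → g x ∈ q) →
  (∀ {x y} → x ∈ p → y ∈ p → g x ≡ g y → x ≡ y) →
  ∣ p ∣ ≤ ∣ q ∣
∣p∣≤∣q∣-injection [] g into inj = z≤n
∣p∣≤∣q∣-injection (outside ∷ p) g into inj =
  ∣p∣≤∣q∣-injection p (g ∘ suc) (into ∘ there)
    λ x∈p y∈p eq → suc-injective (inj (there x∈p) (there y∈p) eq)
∣p∣≤∣q∣-injection (inside ∷ p) {q} g into inj =
  ≤-trans (s≤s (∣p∣≤∣q∣-injection p (g ∘ suc) into′ inj′)) (x∈p⇒∣p-x∣<∣p∣ (into here))
  where
  into′ : ∀ {x} → x ∈ p → g (suc x) ∈ q - g zero
  into′ x∈p = x∈p∧x≢y⇒x∈p-y (into (there x∈p)) λ eq → 0≢1+n (inj here (there x∈p) (sym eq))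
  inj′ : ∀ {x y} → x ∈ p → y ∈ p → g (suc x) ≡ g (suc y) → x ≡ y
  inj′ x∈p y∈p eq = suc-injective (inj (there x∈p) (there y∈p) eq)

∣p∣≤1 : ∀ {n} (p : Subset n) → (∀ {x y} → x ∈ p → y ∈ p → x ≡ y) → ∣ p ∣ ≤ 1
∣p∣≤1 p unique = ∣p∣≤∣q∣-injection p {⊤ {1}} (λ _ → zero) (λ _ → ∈⊤) λ x∈p y∈p _ → unique x∈p y∈p

p⊆q∧∣q∣≤∣p∣⇒q⊆p : ∀ {n} {p q : Subset n} → p ⊆ q → ∣ q ∣ ≤ ∣ p ∣ → q ⊆ p
p⊆q∧∣q∣≤∣p∣⇒q⊆p {p = p} p⊆q ∣q∣≤∣p∣ {y} y∈q with y ∈? p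
... | yes y∈p = y∈p
... | no y∉p = ⊥-elim (<⇒≱ (p⊂q⇒∣p∣<∣q∣ (p⊆q , y , y∈q , y∉p)) ∣q∣≤∣p∣)

chosenIn-exists : ∀ {n} {S : Subset n} → Nonempty S → ∀ x → ∃ (ChosenIn S x)
chosenIn-exists {S = S} nonempty x = choose (any? below?)
  where
  below? : Decidable λ j → j ∈ S × toℕ j ≤ toℕ x
  below? j = j ∈? S ×-dec toℕ j ℕ.≤? toℕ x

  choose : Dec (∃ λ j → j ∈ S × toℕ j ≤ toℕ x) → ∃ (ChosenIn S x)
  choose (yes ∃below) =
    let j , (j∈S , j≤x) , maximal = minimal below? (λ i j → j Fin.<? i) >-wellFounded ∃below
    in j , inj₁ (j∈S , j≤x , λ j' j'∈S j'≤x → ≮⇒≥ (maximal j' (j'∈S , j'≤x)))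
  choose (no ∄below) =
    let j , j∈S , least = minimal (_∈? S) Fin._<?_ <-wellFounded nonempty
    in j , inj₂ ( ∄below , j∈S , ≰⇒> (λ j≤x → ∄below (j , j∈S , j≤x))
                , λ j' j'∈S _ → ≮⇒≥ (least j' j'∈S) )

chosenIn-∈ : ∀ {n} {S : Subset n} {x j} → ChosenIn S x j → j ∈ S
chosenIn-∈ (inj₁ (j∈S , _)) = j∈S
chosenIn-∈ (inj₂ (_ , j∈S , _)) = j∈S

module _ {n} {G S : Subset n} (G-consecutive : Consecutive G) (disjoint : ∀ {s} → s ∈ S → s ∉ G) where

  ≤-constant-on-gap : ∀ {x y s} → x ∈ G → y ∈ G → s ∈ S → toℕ s ≤ toℕ x → toℕ s ≤ toℕ y
  ≤-constant-on-gap {x} {y} {s} x∈G y∈G s∈S s≤x with toℕ s ℕ.≤? toℕ y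
  ... | yes s≤y = s≤y
  ... | no s≰y = ⊥-elim (disjoint s∈S (G-consecutive y s x y∈G x∈G (<⇒≤ (≰⇒> s≰y)) s≤x))

  chosenIn-constant-on-gap : ∀ {x y f} → x ∈ G → y ∈ G → ChosenIn S x f → ChosenIn S y f
  chosenIn-constant-on-gap {x} {y} x∈G y∈G = transfer
    where
    ≤-to-y : ∀ {s} → s ∈ S → toℕ s ≤ toℕ x → toℕ s ≤ toℕ y
    ≤-to-y = ≤-constant-on-gap x∈G y∈G
    ≤-to-x : ∀ {s} → s ∈ S → toℕ s ≤ toℕ y → toℕ s ≤ toℕ x
    ≤-to-x = ≤-constant-on-gap y∈G x∈G
    transfer : ∀ {f} → ChosenIn S x f → ChosenIn S y f
    transfer (inj₁ (f∈S , f≤x , maximal)) =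
      inj₁ (f∈S , ≤-to-y f∈S f≤x , λ j j∈S j≤y → maximal j j∈S (≤-to-x j∈S j≤y))
    transfer (inj₂ (∄below , f∈S , x<f , least)) =
      inj₂ ( (λ (j , j∈S , j≤y) → ∄below (j , j∈S , ≤-to-x j∈S j≤y))
           , f∈S
           , ≰⇒> (λ f≤y → <⇒≱ x<f (≤-to-x f∈S f≤y))
           , λ j j∈S y<j → least j j∈S (≰⇒> λ j≤x → <⇒≱ y<j (≤-to-y j∈S j≤x)) )

module _ {n m} {L : Fin m → Subset n} {I : Subset n} where

  assigned-∈ : ∀ {f x} → Assigned L I f x → f ∈ I
  assigned-∈ (k , _ , chosen) = proj₂ (x∈p∩q⁻ (L k) I (chosenIn-∈ chosen))

  assigned-∈-meeting : ∀ {f x k} → Assigned L I f x → x ∈ L k → Nonempty (L k ∩ I) → f ∈ L k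
  assigned-∈-meeting (k' , (_ , _ , smallest) , chosen) x∈Lk meets =
    smallest _ x∈Lk meets (proj₁ (x∈p∩q⁻ (L k') I (chosenIn-∈ chosen)))

  module _ (laminar : Laminar L) where

    laminar-nested : ∀ {x k k'} → x ∈ L k → x ∈ L k' → L k ⊆ L k' ⊎ L k' ⊆ L k
    laminar-nested {x} {k} {k'} x∈Lk x∈Lk' with laminar k k'
    ... | inj₁ disjoint = ⊥-elim (disjoint x x∈Lk x∈Lk')
    ... | inj₂ nested = nested

    smallestMeeting-exists : (∃ λ k → L k ≡ ⊤) → Nonempty I → ∀ x → ∃ (SmallestMeeting L I x)
    smallestMeeting-exists (kN , LkN≡⊤) (a , a∈I) x =
      smallest-of (minimal candidate? (λ k k' → ∣ L k ∣ ℕ.<? ∣ L k' ∣)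
                     (On.wellFounded (∣_∣ ∘ L) ℕ.<-wellFounded) (kN , N-candidate))
      where
      Candidate : Fin m → Set
      Candidate k = x ∈ L k × Nonempty (L k ∩ I)
      candidate? : Decidable Candidate
      candidate? k = x ∈? L k ×-dec nonempty? (L k ∩ I)
      N-candidate : Candidate kN
      N-candidate = subst (x ∈_) (sym LkN≡⊤) ∈⊤ , a , x∈p∩q⁺ (subst (a ∈_) (sym LkN≡⊤) ∈⊤ , a∈I)

      smallest-of : (∃ λ k → Candidate k × ∀ k' → Candidate k' → ¬ ∣ L k' ∣ < ∣ L k ∣) →
                    ∃ (SmallestMeeting L I x)
      smallest-of (k , (x∈Lk , meets) , smallest) = k , x∈Lk , meets , below
        where
        below : ∀ k' → x ∈ L k' → Nonempty (L k' ∩ I) → L k ⊆ L k'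
        below k' x∈Lk' meets' with laminar-nested x∈Lk x∈Lk'
        ... | inj₁ Lk⊆Lk' = Lk⊆Lk'
        ... | inj₂ Lk'⊆Lk = p⊆q∧∣q∣≤∣p∣⇒q⊆p Lk'⊆Lk (≮⇒≥ (smallest k' (x∈Lk' , meets')))

    assigned-exists : (∃ λ k → L k ≡ ⊤) → Nonempty I → ∀ x → ∃ λ f → Assigned L I f x
    assigned-exists top nonempty x =
      let k , smallest@(_ , meets , _) = smallestMeeting-exists top nonempty x
          f , chosen = chosenIn-exists meets x
      in f , k , smallest , chosen

    missing⊆meeting : ∀ {x k k'} → Empty (L k ∩ I) → x ∈ L k → x ∈ L k' → Nonempty (L k' ∩ I) →
                      L k ⊆ L k'
    missing⊆meeting misses x∈Lk x∈Lk' (s , s∈Lk'∩I) with laminar-nested x∈Lk x∈Lk'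
    ... | inj₁ Lk⊆Lk' = Lk⊆Lk'
    ... | inj₂ Lk'⊆Lk =
      let s∈Lk' , s∈I = x∈p∩q⁻ _ I s∈Lk'∩I in ⊥-elim (misses (s , x∈p∩q⁺ (Lk'⊆Lk s∈Lk' , s∈I)))

    assigned-constant-on-gap : ∀ {k x y f} → Consecutive (L k) → Empty (L k ∩ I) →
      x ∈ L k → y ∈ L k → Assigned L I f x → Assigned L I f y
    assigned-constant-on-gap {k} {y = y} consecutive misses x∈Lk y∈Lk
                             (k' , (x∈Lk' , meets , smallest) , chosen) =
      k' , (Lk⊆Lk' y∈Lk , meets , smallest-for-y) ,
      chosenIn-constant-on-gap consecutive avoids x∈Lk y∈Lk chosen
      where
      Lk⊆Lk' : L k ⊆ L k'
      Lk⊆Lk' = missing⊆meeting misses x∈Lk x∈Lk' meets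
      smallest-for-y : ∀ k'' → y ∈ L k'' → Nonempty (L k'' ∩ I) → L k' ⊆ L k''
      smallest-for-y k'' y∈Lk'' meets'' =
        smallest k'' (missing⊆meeting misses y∈Lk y∈Lk'' meets'' x∈Lk) meets''
      avoids : ∀ {s} → s ∈ L k' ∩ I → s ∉ L k
      avoids s∈Lk'∩I s∈Lk = misses (_ , x∈p∩q⁺ (s∈Lk , proj₂ (x∈p∩q⁻ (L k') I s∈Lk'∩I)))

    module _ (top : ∃ λ k → L k ≡ ⊤) (nonempty : Nonempty I) {J : Subset n}
             (once : ∀ f → f ∈ I → AtMostOneIn J (Assigned L I f)) where

      part : Fin n → Fin n
      part x = proj₁ (assigned-exists top nonempty x)

      assigned-part : ∀ x → Assigned L I (part x) x
      assigned-part x = proj₂ (assigned-exists top nonempty x)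

      same-part⇒≡ : ∀ {x y} → x ∈ J → y ∈ J → Assigned L I (part x) y → x ≡ y
      same-part⇒≡ {x} x∈J y∈J assigned =
        once (part x) (assigned-∈ assigned) x _ x∈J y∈J (assigned-part x) assigned

      ∣J∩L∣≤∣I∩L∣ : ∀ {k} → Nonempty (L k ∩ I) → ∣ J ∩ L k ∣ ≤ ∣ I ∩ L k ∣
      ∣J∩L∣≤∣I∩L∣ {k} meets = ∣p∣≤∣q∣-injection (J ∩ L k) part into injective
        where
        into : ∀ {x} → x ∈ J ∩ L k → part x ∈ I ∩ L k
        into {x} x∈J∩Lk = x∈p∩q⁺ ( assigned-∈ (assigned-part x)
                                 , assigned-∈-meeting (assigned-part x) (proj₂ (x∈p∩q⁻ J (L k) x∈J∩Lk)) meets )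
        injective : ∀ {x y} → x ∈ J ∩ L k → y ∈ J ∩ L k → part x ≡ part y → x ≡ y
        injective {y = y} x∈J∩Lk y∈J∩Lk eq =
          same-part⇒≡ (proj₁ (x∈p∩q⁻ J _ x∈J∩Lk)) (proj₁ (x∈p∩q⁻ J _ y∈J∩Lk))
            (subst (λ f → Assigned L I f y) (sym eq) (assigned-part y))

      ∣J∩L∣≤1 : ∀ {k} → Consecutive (L k) → Empty (L k ∩ I) → ∣ J ∩ L k ∣ ≤ 1
      ∣J∩L∣≤1 {k} consecutive misses = ∣p∣≤1 (J ∩ L k) λ {x} x∈J∩Lk y∈J∩Lk →
        let x∈J , x∈Lk = x∈p∩q⁻ J (L k) x∈J∩Lk
            y∈J , y∈Lk = x∈p∩q⁻ J (L k) y∈J∩Lk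
        in same-part⇒≡ x∈J y∈J
             (assigned-constant-on-gap consecutive misses x∈Lk y∈Lk (assigned-part x))

mainTheorem6 : ∀ {n m} (L : Fin m → Subset n) (b : Fin m → ℕ) →
    Injective _≡_ _≡_ L →
    Laminar L →
    (∀ k → 1 ≤ b k) →
    (∃ λ k → L k ≡ ⊤) →
    (∀ k → Consecutive (L k)) →
    (I J : Subset n) →
    Independent L b I →
    MeetsPartsAtMostOnce L I J →
    Independent L b J
mainTheorem6 L b _ laminar b≥1 top consecutive I J I-independent (once-if-empty , once) k
  with nonempty? I | nonempty? (L k ∩ I)
... | no I-empty | _ =
  ≤-trans (∣p∩q∣≤∣p∣ J (L k)) (≤-trans ∣J∣≤1 (b≥1 k))
  where
  ∣J∣≤1 : ∣ J ∣ ≤ 1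
  ∣J∣≤1 = ∣p∣≤1 J λ x∈J y∈J → once-if-empty I-empty _ _ x∈J y∈J ∈⊤ ∈⊤
... | yes I-nonempty | yes meets =
  ≤-trans (∣J∩L∣≤∣I∩L∣ laminar top I-nonempty once meets) (I-independent k)
... | yes I-nonempty | no misses =
  ≤-trans (∣J∩L∣≤1 laminar top I-nonempty once (consecutive k) misses) (b≥1 k)
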